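{- Let $D$ be a finite simply-laced tree with a vertex $v$ of degree at least $3$ such that at least two connected components of $D\setminus\{v\}$ have at least two vertices each. If a labeling $a$ of $D$ is not fixed, then $a$ is equivalent both to a labeling $a'$ with $a'_v=0$ and to a labeling $a''$ with $a''_v=1$.
   Context: Reeder's puzzle on a finite connected simple graph: a labeling assigns $a_j\in\mathbb{Z}/2\mathbb{Z}$ to each vertex $j$; the move $T_i$ replaces $a_i$ by $a_i+\sum_k a_k \pmod 2$ (sum over the neighbors $k$ of $i$) and leaves all other labels unchanged. Labelings are equivalent if related by a finite sequence of moves; a labeling is fixed if $T_i(a)=a$ for all $i$. -}

module Defs where

open import Data.Nat using (ℕ; zero; suc; _≤_)
open import Data.Bool using (Bool; true; false; _∧_; _xor_; if_then_else_)
open import Data.Fin using (Fin; _≟_)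
open import Data.List using (List; []; _∷_; foldr; filter; length)
open import Data.List.Base using (last)
open import Data.List.Relation.Unary.Unique.Propositional using (Unique)
open import Data.Maybe using (Maybe; just; nothing)
open import Data.Vec using (Vec; tabulate; lookup; allFin)
import Data.List as L
open import Data.Product using (Σ; _×_; ∃-syntax)
open import Data.Unit using (⊤)
open import Data.Empty using (⊥)
open import Relation.Nullary using (¬_; does)
open import Relation.Binary.PropositionalEquality using (_≡_; _≢_)
open import Relation.Binary.Construct.Closure.ReflexiveTransitive using (Star)

record Graph (n : ℕ) : Set where
  field
    adj   : Fin n → Fin n → Bool
    sym   : ∀ i j → adj i j ≡ adj j i
    irrefl : ∀ i → adj i i ≡ false
open Graph public

vertices : (n : ℕ) → List (Fin n)
vertices n = L.allFin n

-- Labelings with values in Z/2Z (Bool, addition = xor)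
Labeling : ℕ → Set
Labeling n = Vec Bool n

nbrSum : ∀ {n} → Graph n → Labeling n → Fin n → Bool
nbrSum {n} G a i = foldr (λ k s → (adj G i k ∧ lookup a k) xor s) false (vertices n)

T : ∀ {n} → Graph n → Fin n → Labeling n → Labeling n
T G i a = tabulate (λ j → if does (j ≟ i) then lookup a i xor nbrSum G a i else lookup a j)

Move : ∀ {n} → Graph n → Labeling n → Labeling n → Set
Move G a b = ∃[ i ] (T G i a ≡ b)

Equivalent : ∀ {n} → Graph n → Labeling n → Labeling n → Set
Equivalent G = Star (Move G)

Fixed : ∀ {n} → Graph n → Labeling n → Set
Fixed G a = ∀ i → T G i a ≡ a

Edge : ∀ {n} → Graph n → Fin n → Fin n → Set
Edge G x y = adj G x y ≡ true

Connected : ∀ {n} → Graph n → Set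
Connected G = ∀ x y → Star (Edge G) x y

Chain : ∀ {n} → Graph n → List (Fin n) → Set
Chain G [] = ⊤
Chain G (x ∷ []) = ⊤
Chain G (x ∷ y ∷ xs) = Edge G x y × Chain G (y ∷ xs)

IsCycle : ∀ {n} → Graph n → List (Fin n) → Set
IsCycle G [] = ⊥
IsCycle G (x ∷ xs) =
  3 ≤ length (x ∷ xs) × Unique (x ∷ xs) × Chain G (x ∷ xs) × LastAdj (last (x ∷ xs))
  where
    LastAdj : Maybe (Fin _) → Set
    LastAdj (just y) = Edge G y x
    LastAdj nothing = ⊤

Acyclic : ∀ {n} → Graph n → Set
Acyclic {n} G = (cs : List (Fin n)) → ¬ IsCycle G cs

IsTree : ∀ {n} → Graph n → Set
IsTree G = Connected G × Acyclic G

degree : ∀ {n} → Graph n → Fin n → ℕ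
degree {n} G v = length (filter (λ k → Data.Bool._≟_ (adj G v k) true) (vertices n))
  where import Data.Bool

SameCompMinus : ∀ {n} → Graph n → Fin n → Fin n → Fin n → Set
SameCompMinus G v x y =
  x ≢ v × y ≢ v × Star (λ p q → Edge G p q × p ≢ v × q ≢ v) x y

-- at least two connected components of G ∖ {v} have at least two vertices each
TwoBigComponents : ∀ {n} → Graph n → Fin n → Set
TwoBigComponents G v =
  ∃[ x₁ ] ∃[ y₁ ] ∃[ x₂ ] ∃[ y₂ ]
    (x₁ ≢ y₁ × SameCompMinus G v x₁ y₁ ×
     x₂ ≢ y₂ × SameCompMinus G v x₂ y₂ ×
     ¬ SameCompMinus G v x₁ x₂)

-- Call a vertex i active for a labeling a if the sum of the labels of its
-- neighbours is 1, i.e. if T_i changes a (and then T_i flips a_i). A labeling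
-- is not fixed exactly when some vertex is active. Applying T_x at an active x
-- adds 1 to the neighbour sum of every neighbour z of x, so along an edge x–z
-- either z is already active or it becomes active after T_x. Walking along a
-- path we make v active, and then T_v toggles a_v.
module Submission where

open import Defs hiding (sym)
open import Level using (0ℓ)
open import Algebra.Bundles using (CommutativeMonoid; CommutativeRing)
open import Data.Nat using (ℕ; _≤_; zero; suc)
open import Data.Fin using (Fin; zero; suc; _≟_)
open import Data.Fin.Properties using (any?)
open import Data.Bool using (Bool; true; false; not; _xor_; _∧_; if_then_else_)
import Data.Bool as Bool
open import Data.Bool.Properties
  using ( xor-identityʳ; xor-comm; ∧-zeroʳ; ∧-distribˡ-xor; ¬-not
        ; ∧-commutativeMonoid; xor-∧-commutativeRing)
open import Data.Vec using (lookup; tabulate)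
open import Data.Vec.Properties using (lookup∘tabulate; tabulate-cong; tabulate∘lookup)
import Data.List as List
open import Data.Product using (_×_; ∃-syntax; _,_)
open import Relation.Nullary using (¬_; yes; no; does; contradiction)
open import Relation.Nullary.Decidable using (dec-true)
open import Relation.Binary.PropositionalEquality
  using (_≡_; refl; sym; trans; cong; cong₂; module ≡-Reasoning)
open import Relation.Binary.Construct.Closure.ReflexiveTransitive
  using (Star; ε; _◅_; _◅◅_)

open import Algebra.Properties.CommutativeSemigroup
  (CommutativeMonoid.commutativeSemigroup ∧-commutativeMonoid)
  using (x∙yz≈y∙xz)

xor-commutativeMonoid : CommutativeMonoid 0ℓ 0ℓ
xor-commutativeMonoid = CommutativeRing.+-commutativeMonoid xor-∧-commutativeRing

open import Algebra.Properties.CommutativeMonoid.Sum xor-commutativeMonoid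
  using (sum; ∑-distrib-+; sum-cong-≗; sum-replicate-zero)

open ≡-Reasoning

foldr-xor-tabulate : ∀ {n m} (f : Fin m → Bool) (g : Fin n → Fin m) →
  List.foldr (λ k s → f k xor s) false (List.tabulate g) ≡ sum (λ k → f (g k))
foldr-xor-tabulate {zero}  f g = refl
foldr-xor-tabulate {suc n} f g = cong (f (g zero) xor_) (foldr-xor-tabulate f (λ k → g (suc k)))

∑-δ : ∀ {n} (x : Fin n) (f : Fin n → Bool) → sum (λ k → does (k ≟ x) ∧ f k) ≡ f x
∑-δ {suc n} zero f = trans (cong (f zero xor_) (sum-replicate-zero n)) (xor-identityʳ (f zero))
∑-δ (suc x) f = ∑-δ x (λ k → f (suc k))

module _ {n : ℕ} (G : Graph n) where

  nbrSum≡∑ : ∀ a i → nbrSum G a i ≡ sum (λ k → adj G i k ∧ lookup a k)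
  nbrSum≡∑ a i = foldr-xor-tabulate (λ k → adj G i k ∧ lookup a k) (λ k → k)

  lookup-T : ∀ i a j → lookup (T G i a) j ≡ lookup a j xor (does (j ≟ i) ∧ nbrSum G a i)
  lookup-T i a j with lookup∘tabulate
    (λ j → if does (j ≟ i) then lookup a i xor nbrSum G a i else lookup a j) j
  ... | eq with j ≟ i
  ...   | yes refl = eq
  ...   | no _     = trans eq (sym (xor-identityʳ (lookup a j)))

  nbrSum-T : ∀ x a z → nbrSum G (T G x a) z ≡ nbrSum G a z xor (adj G z x ∧ nbrSum G a x)
  nbrSum-T x a z = begin
    nbrSum G (T G x a) z
      ≡⟨ nbrSum≡∑ (T G x a) z ⟩
    sum (λ k → adj G z k ∧ lookup (T G x a) k)
      ≡⟨ sum-cong-≗ (λ k → cong (adj G z k ∧_) (lookup-T x a k)) ⟩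
    sum (λ k → adj G z k ∧ (lookup a k xor (δ k ∧ s)))
      ≡⟨ sum-cong-≗ (λ k → ∧-distribˡ-xor (adj G z k) (lookup a k) (δ k ∧ s)) ⟩
    sum (λ k → (adj G z k ∧ lookup a k) xor (adj G z k ∧ (δ k ∧ s)))
      ≡⟨ ∑-distrib-+ (λ k → adj G z k ∧ lookup a k) (λ k → adj G z k ∧ (δ k ∧ s)) ⟩
    sum (λ k → adj G z k ∧ lookup a k) xor sum (λ k → adj G z k ∧ (δ k ∧ s))
      ≡⟨ cong₂ _xor_ (sym (nbrSum≡∑ a z)) (sum-cong-≗ (λ k → x∙yz≈y∙xz (adj G z k) (δ k) s)) ⟩
    nbrSum G a z xor sum (λ k → δ k ∧ (adj G z k ∧ s))
      ≡⟨ cong (nbrSum G a z xor_) (∑-δ x (λ k → adj G z k ∧ s)) ⟩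
    nbrSum G a z xor (adj G z x ∧ s)
      ∎
    where
    s : Bool
    s = nbrSum G a x
    δ : Fin n → Bool
    δ k = does (k ≟ x)

  Active : Labeling n → Fin n → Set
  Active a i = nbrSum G a i ≡ true

  T-inactive : ∀ i a → nbrSum G a i ≡ false → T G i a ≡ a
  T-inactive i a inactive = begin
    T G i a                     ≡⟨ sym (tabulate∘lookup (T G i a)) ⟩
    tabulate (lookup (T G i a)) ≡⟨ tabulate-cong unchanged ⟩
    tabulate (lookup a)         ≡⟨ tabulate∘lookup a ⟩
    a                           ∎
    where
    unchanged : ∀ j → lookup (T G i a) j ≡ lookup a j
    unchanged j = begin
      lookup (T G i a) j                             ≡⟨ lookup-T i a j ⟩
      lookup a j xor (does (j ≟ i) ∧ nbrSum G a i)   ≡⟨ cong (λ s → lookup a j xor (does (j ≟ i) ∧ s)) inactive ⟩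
      lookup a j xor (does (j ≟ i) ∧ false)          ≡⟨ cong (lookup a j xor_) (∧-zeroʳ (does (j ≟ i))) ⟩
      lookup a j xor false                           ≡⟨ xor-identityʳ (lookup a j) ⟩
      lookup a j                                     ∎

  T-active-flips : ∀ i a → Active a i → lookup (T G i a) i ≡ not (lookup a i)
  T-active-flips i a active = begin
    lookup (T G i a) i
      ≡⟨ lookup-T i a i ⟩
    lookup a i xor (does (i ≟ i) ∧ nbrSum G a i)
      ≡⟨ cong₂ (λ d t → lookup a i xor (d ∧ t)) (dec-true (i ≟ i) refl) active ⟩
    lookup a i xor true
      ≡⟨ xor-comm (lookup a i) true ⟩
    not (lookup a i)
      ∎

  ¬Fixed⇒active : ∀ a → ¬ Fixed G a → ∃[ i ] Active a i
  ¬Fixed⇒active a notFixed with any? (λ i → nbrSum G a i Bool.≟ true)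
  ... | yes active = active
  ... | no noneActive =
    contradiction (λ i → T-inactive i a (¬-not (λ active → noneActive (i , active)))) notFixed

  T-activates-neighbour : ∀ x a z → Edge G x z → Active a x → nbrSum G a z ≡ false →
    Active (T G x a) z
  T-activates-neighbour x a z edge xActive zInactive = begin
    nbrSum G (T G x a) z
      ≡⟨ nbrSum-T x a z ⟩
    nbrSum G a z xor (adj G z x ∧ nbrSum G a x)
      ≡⟨ cong₂ (λ s e → s xor (e ∧ nbrSum G a x)) zInactive (trans (Graph.sym G z x) edge) ⟩
    nbrSum G a x
      ≡⟨ xActive ⟩
    true
      ∎

  activate-along : ∀ {x y} → Star (Edge G) x y → ∀ a → Active a x →
    ∃[ b ] (Equivalent G a b × Active b y)
  activate-along ε a xActive = a , ε , xActive
  activate-along {x} (_◅_ {j = z} edge path) a xActive with nbrSum G a z in zSum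
  ... | true  = activate-along path a zSum
  ... | false with activate-along path (T G x a) (T-activates-neighbour x a z edge xActive zSum)
  ...   | b , a~b , yActive = b , (x , refl) ◅ a~b , yActive

  ¬Fixed⇒reaches-label : Connected G → ∀ a → ¬ Fixed G a → ∀ v c →
    ∃[ b ] (Equivalent G a b × lookup b v ≡ c)
  ¬Fixed⇒reaches-label connected a notFixed v c with ¬Fixed⇒active a notFixed
  ... | i , iActive with activate-along (connected i v) a iActive
  ...   | b , a~b , vActive with c Bool.≟ lookup b v
  ...     | yes c≡bv = b , a~b , sym c≡bv
  ...     | no c≢bv  = T G v b , a~b ◅◅ ((v , refl) ◅ ε) ,
                       trans (T-active-flips v b vActive) (sym (¬-not c≢bv))

lemma3p3 : {n : ℕ} (D : Graph n) → IsTree D → (v : Fin n) →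
    3 ≤ degree D v → TwoBigComponents D v →
    (a : Labeling n) → ¬ Fixed D a →
    (∃[ a′ ] (Equivalent D a a′ × lookup a′ v ≡ false)) ×
    (∃[ a″ ] (Equivalent D a a″ × lookup a″ v ≡ true))
lemma3p3 D (connected , _) v _ _ a notFixed =
  ¬Fixed⇒reaches-label D connected a notFixed v false ,
  ¬Fixed⇒reaches-label D connected a notFixed v true
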